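{- Let $C$ be a p.c.o. group which is a wound-round, i.e. $C\cong G/\mathbb{Z}u$ for some unital partially ordered abelian group $(G,u)$. Then for all $x,y\in A(C)$: $y-x\in A(C)\iff(x\leq_0y \text{ or } y\leq_0x)$, and $x+y\in A(C)\iff(x\leq_0-y\text{ or }-y\leq_0x)$.
   Context: A unital partially ordered group $(G,u)$ is a partially ordered abelian group with a distinguished strong unit $u>0$. Its wound-round is $G/\mathbb{Z}u$ with canonical map $\rho$ and ternary relation $R(\rho(x_1),\rho(x_2),\rho(x_3))$ iff there exist $n_2,n_3\in\mathbb{Z}$ with $x_1<x_2+n_2u<x_3+n_3u<x_1+u$; it is a partially cyclically ordered (p.c.o.) group. In a p.c.o. group, $y\leq_0 z$ means $R(0,y,z)$ or $y=z$ or $y=0$, and $<_0$ is its strict version. $A(C)$ consists of $0$ and all $x\in C\setminus\{0\}$ for which some $y\in C\setminus\{0\}$ satisfies $x<_0y$ or $y<_0x$. -}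

module Defs where

open import Level using (Level; _⊔_; suc)
open import Algebra.Bundles using (AbelianGroup)
open import Relation.Binary.Structures using (IsPartialOrder)
open import Relation.Binary.Core using (Rel)
open import Data.Nat using (ℕ; zero) renaming (suc to sucℕ)
open import Data.Integer using (ℤ; +_; -[1+_])
open import Data.Product using (Σ; _×_; ∃; ∃-syntax)
open import Data.Sum using (_⊎_)
open import Relation.Nullary using (¬_)

record POAbelianGroup (c ℓ₁ ℓ₂ : Level) : Set (Level.suc (c ⊔ ℓ₁ ⊔ ℓ₂)) where
  field
    abelianGroup   : AbelianGroup c ℓ₁
  open AbelianGroup abelianGroup public
  field
    _≤_            : Rel Carrier ℓ₂
    isPartialOrder : IsPartialOrder _≈_ _≤_
    ≤-translate    : ∀ {x y} z → x ≤ y → (x ∙ z) ≤ (y ∙ z)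

  _<_ : Carrier → Carrier → Set (ℓ₁ ⊔ ℓ₂)
  x < y = (x ≤ y) × ¬ (x ≈ y)

  _×ℕ_ : ℕ → Carrier → Carrier
  zero   ×ℕ x = ε
  sucℕ n ×ℕ x = x ∙ (n ×ℕ x)

  _×ℤ_ : ℤ → Carrier → Carrier
  (+ n)    ×ℤ x = n ×ℕ x
  -[1+ n ] ×ℤ x = (sucℕ n ×ℕ x) ⁻¹

record UnitalPOGroup (c ℓ₁ ℓ₂ : Level) : Set (Level.suc (c ⊔ ℓ₁ ⊔ ℓ₂)) where
  field
    poGroup    : POAbelianGroup c ℓ₁ ℓ₂
  open POAbelianGroup poGroup public
  field
    u          : Carrier
    u-positive : ε < u
    u-strong   : ∀ x → ∃[ n ] (x ≤ (n ×ℕ u))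

  -- Since Agda has no quotient types,
  -- elements of C are represented by elements of G (via ρ = identity on
  -- representatives), and equality in C is the congruence _≈C_.

  _≈C_ : Carrier → Carrier → Set ℓ₁
  x ≈C y = ∃[ n ] (x ≈ (y ∙ (n ×ℤ u)))

  -- the cyclic order R(ρ x₁, ρ x₂, ρ x₃)
  R : Carrier → Carrier → Carrier → Set (ℓ₁ ⊔ ℓ₂)
  R x₁ x₂ x₃ = ∃[ n₂ ] ∃[ n₃ ]
    ( (x₁ < (x₂ ∙ (n₂ ×ℤ u)))
    × ((x₂ ∙ (n₂ ×ℤ u)) < (x₃ ∙ (n₃ ×ℤ u)))
    × ((x₃ ∙ (n₃ ×ℤ u)) < (x₁ ∙ u)) )

  _≤₀_ : Carrier → Carrier → Set (ℓ₁ ⊔ ℓ₂)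
  y ≤₀ z = R ε y z ⊎ (y ≈C z ⊎ y ≈C ε)

  _<₀_ : Carrier → Carrier → Set (ℓ₁ ⊔ ℓ₂)
  y <₀ z = (y ≤₀ z) × ¬ (y ≈C z)

  A : Carrier → Set (c ⊔ ℓ₁ ⊔ ℓ₂)
  A x = (x ≈C ε) ⊎
        (¬ (x ≈C ε) × ∃[ y ] (¬ (y ≈C ε) × ((x <₀ y) ⊎ (y <₀ x))))

module Submission where

-- Every class has at most one representative in the
-- fundamental domain [0,u), and R(0,x,y) says precisely that x and y have
-- representatives 0 < a < b < u.  Hence a nonzero class w lies in A(C)
-- iff it is "anchored": represented by some d ∈ (0,u) that is strictly
-- comparable with another e ∈ (0,u).  Anchored classes are stable under
-- negation (d ↦ u − d reverses the order on (0,u)), and R(0,x,y) makes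
-- y − x anchored (its representative b − a lies in (0,b)); this gives "⇐".
-- For "⇒", take representatives z, a, b ∈ (0,u) of y − x, x, y: then
-- z + a ≡ b, and since 0 < z + a < 2u either b = z + a > a or
-- b = z + a − u < a, i.e. R(0,x,y) or R(0,y,x).  The statement about
-- x + y is the one about −y − x = −(x + y), since A(C) is closed under negation.

open import Defs
open import Level using (Level)
open import Data.Product using (_×_)
open import Data.Sum using (_⊎_)
open import Function.Bundles using (_⇔_)

open import Level using (_⊔_)
open import Data.Product using (∃-syntax; _,_; proj₁; proj₂)
open import Data.Sum using (inj₁; inj₂)
open import Data.Nat using (ℕ; zero) renaming (suc to sucℕ; _+_ to _+ℕ_)
open import Data.Integer using (+_; -[1+_])
open import Data.Empty using (⊥-elim)
open import Relation.Nullary using (¬_)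
open import Function.Bundles using (mk⇔)
open import Function.Construct.Composition using (_⇔-∘_)
open import Relation.Binary.Bundles using (Poset)
open import Relation.Binary.Structures using (IsPartialOrder)
import Algebra.Properties.AbelianGroup as AbelianGroupProperties
import Algebra.Properties.CommutativeSemigroup as CommutativeSemigroupProperties
import Relation.Binary.Construct.NonStrictToStrict as NonStrictToStrict
import Relation.Binary.Properties.Poset as PosetProperties
import Relation.Binary.Reasoning.Setoid as SetoidReasoning

module OrderedAbelianGroup {c ℓ₁ ℓ₂ : Level} (G : POAbelianGroup c ℓ₁ ℓ₂) where
  open POAbelianGroup G
  open AbelianGroupProperties abelianGroup
  open IsPartialOrder isPartialOrder using (antisym; ≤-respˡ-≈; ≤-respʳ-≈)
    renaming (trans to ≤-trans; refl to ≤-refl)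
  open SetoidReasoning setoid

  -- The strict order _<_ of G is definitionally the library's strict order of
  -- this poset, so the library's lemmas about it apply directly.
  poset : Poset c ℓ₁ ℓ₂
  poset = record { isPartialOrder = isPartialOrder }

  open PosetProperties poset public
    using (<-trans; <-irrefl; <-respˡ-≈; <-respʳ-≈; <⇒≱; <⇒≉)

  ≤-<-trans : ∀ {x y z} → x ≤ y → y < z → x < z
  ≤-<-trans = NonStrictToStrict.≤-<-trans _≈_ _≤_ ≤-trans antisym ≤-respˡ-≈

  ≤-translateˡ : ∀ {x y} z → x ≤ y → (z ∙ x) ≤ (z ∙ y)
  ≤-translateˡ {x} {y} z x≤y = ≤-respˡ-≈ (comm x z) (≤-respʳ-≈ (comm y z) (≤-translate z x≤y))

  <-translateʳ : ∀ {x y} z → x < y → (x ∙ z) < (y ∙ z)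
  <-translateʳ {x} {y} z (x≤y , x≉y) = ≤-translate z x≤y , λ e → x≉y (∙-cancelʳ z x y e)

  <-translateˡ : ∀ {x y} z → x < y → (z ∙ x) < (z ∙ y)
  <-translateˡ {x} {y} z x<y = <-respˡ-≈ (comm x z) (<-respʳ-≈ (comm y z) (<-translateʳ z x<y))

  <-cancelʳ : ∀ {x y} z → (x ∙ z) < (y ∙ z) → x < y
  <-cancelʳ {x} {y} z xz<yz =
    <-respˡ-≈ (//-rightDividesʳ z x) (<-respʳ-≈ (//-rightDividesʳ z y) (<-translateʳ (z ⁻¹) xz<yz))

  ≤-∙ : ∀ {a b c d} → a ≤ b → c ≤ d → (a ∙ c) ≤ (b ∙ d)
  ≤-∙ {b = b} {c = c} a≤b c≤d = ≤-trans (≤-translate c a≤b) (≤-translateˡ b c≤d)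

  ⁻¹-antitone : ∀ {a b} → a < b → (b ⁻¹) < (a ⁻¹)
  ⁻¹-antitone {a} {b} a<b = <-respˡ-≈ left (<-respʳ-≈ right (<-translateˡ (a ⁻¹ ∙ b ⁻¹) a<b))
    where
    left : (a ⁻¹ ∙ b ⁻¹) ∙ a ≈ b ⁻¹
    left = begin
      (a ⁻¹ ∙ b ⁻¹) ∙ a ≈⟨ ∙-congʳ (comm (a ⁻¹) (b ⁻¹)) ⟩
      (b ⁻¹ ∙ a ⁻¹) ∙ a ≈⟨ //-rightDividesˡ a (b ⁻¹) ⟩
      b ⁻¹              ∎
    right : (a ⁻¹ ∙ b ⁻¹) ∙ b ≈ a ⁻¹
    right = //-rightDividesˡ b (a ⁻¹)

  <⇒difference-positive : ∀ {a b} → a < b → ε < (b ∙ a ⁻¹)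
  <⇒difference-positive {a} a<b = <-respˡ-≈ (inverseʳ a) (<-translateʳ (a ⁻¹) a<b)

  positive⇒difference< : ∀ {a} b → ε < a → (b ∙ a ⁻¹) < b
  positive⇒difference< {a} b ε<a =
    <-respʳ-≈ (identityʳ b) (<-translateˡ b (<-respʳ-≈ ε⁻¹≈ε (⁻¹-antitone ε<a)))

module WoundRound {c ℓ₁ ℓ₂ : Level} (G : UnitalPOGroup c ℓ₁ ℓ₂) where
  open UnitalPOGroup G
  open AbelianGroupProperties abelianGroup
  open CommutativeSemigroupProperties commutativeSemigroup using (interchange; x∙yz≈xz∙y)
  open IsPartialOrder isPartialOrder using (≤-respˡ-≈; ≤-respʳ-≈) renaming (refl to ≤-refl)
  open OrderedAbelianGroup poGroup
  open SetoidReasoning setoid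

  private
    variable
      a b d e w x y z : Carrier

  ×ℕu-nonnegative : ∀ n → ε ≤ (n ×ℕ u)
  ×ℕu-nonnegative zero     = ≤-refl
  ×ℕu-nonnegative (sucℕ n) = ≤-respˡ-≈ (identityˡ ε) (≤-∙ (proj₁ u-positive) (×ℕu-nonnegative n))

  ×ℕu-+ : ∀ p q → (p ×ℕ u) ∙ (q ×ℕ u) ≈ (p +ℕ q) ×ℕ u
  ×ℕu-+ zero     q = identityˡ (q ×ℕ u)
  ×ℕu-+ (sucℕ p) q = trans (assoc u (p ×ℕ u) (q ×ℕ u)) (∙-congˡ (×ℕu-+ p q))

  u≤shift : ∀ m → ε ≤ b → u ≤ (b ∙ (sucℕ m ×ℕ u))
  u≤shift m ε≤b =
    ≤-respˡ-≈ (trans (identityˡ (u ∙ ε)) (identityʳ u))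
              (≤-∙ ε≤b (≤-translateˡ u (×ℕu-nonnegative m)))

  Multiple : Carrier → Set ℓ₁
  Multiple z = ∃[ n ] (z ≈ (n ×ℤ u))

  Multiple-resp : x ≈ y → Multiple x → Multiple y
  Multiple-resp x≈y (n , e) = n , trans (sym x≈y) e

  Multiple-⁻¹ : Multiple z → Multiple (z ⁻¹)
  Multiple-⁻¹ (+ zero   , e) = + 0 , trans (⁻¹-cong e) ε⁻¹≈ε
  Multiple-⁻¹ (+ sucℕ n , e) = -[1+ n ] , ⁻¹-cong e
  Multiple-⁻¹ (-[1+ n ] , e) = + sucℕ n , trans (⁻¹-cong e) (⁻¹-involutive _)

  -- Closure under addition goes through differences p·u − q·u of natural
  -- multiples: every integer multiple is one, and conversely.
  _⊖u_ : ℕ → ℕ → Carrier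
  p ⊖u q = (p ×ℕ u) ∙ (q ×ℕ u) ⁻¹

  multiple⇒⊖u : ∀ n → ∃[ p ] ∃[ q ] ((n ×ℤ u) ≈ p ⊖u q)
  multiple⇒⊖u (+ p)    = p , 0 , sym (trans (∙-congˡ ε⁻¹≈ε) (identityʳ _))
  multiple⇒⊖u -[1+ q ] = 0 , sucℕ q , sym (identityˡ _)

  ⊖u⇒multiple : ∀ p q → Multiple (p ⊖u q)
  ⊖u⇒multiple p        zero     = + p , trans (∙-congˡ ε⁻¹≈ε) (identityʳ _)
  ⊖u⇒multiple zero     (sucℕ q) = -[1+ q ] , identityˡ _
  ⊖u⇒multiple (sucℕ p) (sucℕ q) = Multiple-resp (sym cancel-u) (⊖u⇒multiple p q)
    where
    cancel-u : sucℕ p ⊖u sucℕ q ≈ p ⊖u q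
    cancel-u = begin
      (u ∙ (p ×ℕ u)) ∙ (u ∙ (q ×ℕ u)) ⁻¹      ≈⟨ ∙-congˡ (⁻¹-∙-comm u (q ×ℕ u)) ⟨
      (u ∙ (p ×ℕ u)) ∙ (u ⁻¹ ∙ (q ×ℕ u) ⁻¹)   ≈⟨ interchange u (p ×ℕ u) (u ⁻¹) ((q ×ℕ u) ⁻¹) ⟩
      (u ∙ u ⁻¹) ∙ (p ⊖u q)                  ≈⟨ ∙-congʳ (inverseʳ u) ⟩
      ε ∙ (p ⊖u q)                           ≈⟨ identityˡ _ ⟩
      p ⊖u q                                 ∎

  ⊖u-∙ : ∀ p q p′ q′ → (p ⊖u q) ∙ (p′ ⊖u q′) ≈ (p +ℕ p′) ⊖u (q +ℕ q′)
  ⊖u-∙ p q p′ q′ = begin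
    (p ⊖u q) ∙ (p′ ⊖u q′)                               ≈⟨ interchange (p ×ℕ u) _ (p′ ×ℕ u) _ ⟩
    ((p ×ℕ u) ∙ (p′ ×ℕ u)) ∙ ((q ×ℕ u) ⁻¹ ∙ (q′ ×ℕ u) ⁻¹) ≈⟨ ∙-cong (×ℕu-+ p p′) (⁻¹-∙-comm _ _) ⟩
    ((p +ℕ p′) ×ℕ u) ∙ ((q ×ℕ u) ∙ (q′ ×ℕ u)) ⁻¹         ≈⟨ ∙-congˡ (⁻¹-cong (×ℕu-+ q q′)) ⟩
    (p +ℕ p′) ⊖u (q +ℕ q′)                              ∎

  Multiple-∙ : Multiple y → Multiple z → Multiple (y ∙ z)
  Multiple-∙ (n , e) (n′ , e′) with multiple⇒⊖u n | multiple⇒⊖u n′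
  ... | p , q , f | p′ , q′ , f′ =
    Multiple-resp (sym (trans (∙-cong (trans e f) (trans e′ f′)) (⊖u-∙ p q p′ q′)))
                  (⊖u⇒multiple (p +ℕ p′) (q +ℕ q′))

  mk≈C : Multiple z → x ≈ y ∙ z → x ≈C y
  mk≈C (n , e) x≈yz = n , trans x≈yz (∙-congˡ e)

  ≈⇒≈C : x ≈ y → x ≈C y
  ≈⇒≈C {y = y} x≈y = mk≈C (+ 0 , refl) (trans x≈y (sym (identityʳ y)))

  ≈C-sym : x ≈C y → y ≈C x
  ≈C-sym {y = y} (n , e) =
    mk≈C (Multiple-⁻¹ (n , refl)) (trans (sym (//-rightDividesʳ _ y)) (∙-congʳ (sym e)))

  ≈C-trans : x ≈C y → y ≈C z → x ≈C z
  ≈C-trans {z = z} (n , e) (m , f) =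
    mk≈C (Multiple-∙ (m , refl) (n , refl)) (trans e (trans (∙-congʳ f) (assoc z _ _)))

  ≈C-∙ : x ≈C y → z ≈C w → (x ∙ z) ≈C (y ∙ w)
  ≈C-∙ {y = y} {w = w} (n , e) (m , f) =
    mk≈C (Multiple-∙ (n , refl) (m , refl)) (trans (∙-cong e f) (interchange y _ w _))

  ≈C-⁻¹ : x ≈C y → (x ⁻¹) ≈C (y ⁻¹)
  ≈C-⁻¹ {y = y} (n , e) =
    mk≈C (Multiple-⁻¹ (n , refl)) (trans (⁻¹-cong e) (sym (⁻¹-∙-comm y _)))

  u≈Cε : u ≈C ε
  u≈Cε = mk≈C (+ 1 , sym (identityʳ u)) (sym (identityˡ u))

  shift≈C : ∀ x n → (x ∙ (n ×ℤ u)) ≈C x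
  shift≈C x n = mk≈C (n , refl) refl

  ≈C-cases : x ≈C y →
    (x ≈ y) ⊎ (∃[ m ] (x ≈ y ∙ (sucℕ m ×ℕ u))) ⊎ (∃[ m ] (y ≈ x ∙ (sucℕ m ×ℕ u)))
  ≈C-cases         (+ zero   , e) = inj₁ (trans e (identityʳ _))
  ≈C-cases         (+ sucℕ m , e) = inj₂ (inj₁ (m , e))
  ≈C-cases {y = y} (-[1+ m ] , e) = inj₂ (inj₂ (m , sym (trans (∙-congʳ e) (//-rightDividesˡ _ y))))

  Fundamental : Carrier → Set (ℓ₁ ⊔ ℓ₂)
  Fundamental d = (ε ≤ d) × (d < u)

  Interior : Carrier → Set (ℓ₁ ⊔ ℓ₂)
  Interior d = (ε < d) × (d < u)

  interior⇒fundamental : Interior d → Fundamental d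
  interior⇒fundamental (ε<d , d<u) = proj₁ ε<d , d<u

  shift-escapes : ∀ m → a < u → ε ≤ b → ¬ (a ≈ b ∙ (sucℕ m ×ℕ u))
  shift-escapes m a<u ε≤b a≈shift = <⇒≱ a<u (≤-respʳ-≈ (sym a≈shift) (u≤shift m ε≤b))

  fundamental-unique : Fundamental a → Fundamental b → a ≈C b → a ≈ b
  fundamental-unique (ε≤a , a<u) (ε≤b , b<u) a≈Cb with ≈C-cases a≈Cb
  ... | inj₁ a≈b              = a≈b
  ... | inj₂ (inj₁ (m , a≈s)) = ⊥-elim (shift-escapes m a<u ε≤b a≈s)
  ... | inj₂ (inj₂ (m , b≈s)) = ⊥-elim (shift-escapes m b<u ε≤a b≈s)

  interior-nonzero : Interior d → ¬ (d ≈C ε)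
  interior-nonzero Id@(ε<d , _) d≈Cε =
    <⇒≉ ε<d (sym (fundamental-unique (interior⇒fundamental Id) (≤-refl , u-positive) d≈Cε))

  comparable-incongruent : w ≈C d → Interior d → Interior e → (d < e) ⊎ (e < d) → ¬ (w ≈C e)
  comparable-incongruent w≈Cd Id Ie d⋚e w≈Ce with
    fundamental-unique (interior⇒fundamental Id) (interior⇒fundamental Ie) (≈C-trans (≈C-sym w≈Cd) w≈Ce)
  comparable-incongruent _ _ _ (inj₁ d<e) _ | d≈e = <-irrefl d≈e d<e
  comparable-incongruent _ _ _ (inj₂ e<d) _ | d≈e = <-irrefl (sym d≈e) e<d

  interior-reflect : Interior d → Interior (u ∙ d ⁻¹)
  interior-reflect (ε<d , d<u) = <⇒difference-positive d<u , positive⇒difference< u ε<d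

  -- If z + a ≡ b (mod u) for z, a, b ∈ (0,u), then b = z + a > a or
  -- b = z + a − u < a; a larger shift would push z + a above u or below 0.
  interior-sum-comparable : ∀ {z a b} → Interior z → Interior a → Interior b → (z ∙ a) ≈C b → (a < b) ⊎ (b < a)
  interior-sum-comparable {z} {a} {b} (ε<z , z<u) (ε<a , _) (_ , b<u) za≈Cb with ≈C-cases za≈Cb
  ... | inj₁ za≈b = inj₁ (<-respʳ-≈ za≈b (<-respˡ-≈ (identityˡ a) (<-translateʳ a ε<z)))
  ... | inj₂ (inj₂ (m , b≈s)) = ⊥-elim (shift-escapes m b<u ε≤za b≈s)
    where
    ε≤za : ε ≤ (z ∙ a)
    ε≤za = ≤-respˡ-≈ (identityˡ ε) (≤-∙ (proj₁ ε<z) (proj₁ ε<a))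
  ... | inj₂ (inj₁ (m , za≈s)) = inj₂ (≤-<-trans b≤b+mu (<-cancelʳ u b+mu+u<a+u))
    where
    b≤b+mu : b ≤ (b ∙ (m ×ℕ u))
    b≤b+mu = ≤-respˡ-≈ (identityʳ b) (≤-translateˡ b (×ℕu-nonnegative m))
    b+mu+u<a+u : ((b ∙ (m ×ℕ u)) ∙ u) < (a ∙ u)
    b+mu+u<a+u = <-respˡ-≈ (trans za≈s (x∙yz≈xz∙y b u (m ×ℕ u)))
                           (<-respʳ-≈ (comm u a) (<-translateʳ a z<u))

  Ascending : Carrier → Carrier → Set (c ⊔ ℓ₁ ⊔ ℓ₂)
  Ascending x y = ∃[ a ] ∃[ b ] ((x ≈C a) × (y ≈C b) × (ε < a) × (a < b) × (b < u))

  R₀⇒ascending : ∀ {x y} → R ε x y → Ascending x y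
  R₀⇒ascending {x} {y} (n₂ , n₃ , ε<a , a<b , b<u) =
    _ , _ , ≈C-sym (shift≈C x n₂) , ≈C-sym (shift≈C y n₃) , ε<a , a<b , <-respʳ-≈ (identityˡ u) b<u

  ascending⇒R₀ : Ascending x y → R ε x y
  ascending⇒R₀ (a , b , x≈Ca , y≈Cb , ε<a , a<b , b<u) with ≈C-sym x≈Ca | ≈C-sym y≈Cb
  ... | n₂ , a≈x′ | n₃ , b≈y′ =
    n₂ , n₃ , <-respʳ-≈ a≈x′ ε<a , <-respˡ-≈ a≈x′ (<-respʳ-≈ b≈y′ a<b) ,
    <-respˡ-≈ b≈y′ (<-respʳ-≈ (sym (identityˡ u)) b<u)

  <₀-nonzero⇒ascending : ¬ (x ≈C ε) → x <₀ y → Ascending x y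
  <₀-nonzero⇒ascending _   (inj₁ r , _)            = R₀⇒ascending r
  <₀-nonzero⇒ascending _   (inj₂ (inj₁ x≈Cy) , x≉y) = ⊥-elim (x≉y x≈Cy)
  <₀-nonzero⇒ascending x≠0 (inj₂ (inj₂ x≈Cε) , _)   = ⊥-elim (x≠0 x≈Cε)

  -- The nonzero elements of A(C): those represented by a point of (0,u)
  -- strictly comparable with another point of (0,u).

  Anchored : Carrier → Set (c ⊔ ℓ₁ ⊔ ℓ₂)
  Anchored w = ∃[ d ] ∃[ e ] ((w ≈C d) × Interior d × Interior e × ((d < e) ⊎ (e < d)))

  A⇒zero⊎anchored : A w → (w ≈C ε) ⊎ Anchored w
  A⇒zero⊎anchored (inj₁ w≈Cε) = inj₁ w≈Cε
  A⇒zero⊎anchored (inj₂ (w≠0 , _ , _ , inj₁ w<₀y)) with <₀-nonzero⇒ascending w≠0 w<₀y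
  ... | a , b , w≈Ca , _ , ε<a , a<b , b<u =
    inj₂ (a , b , w≈Ca , (ε<a , <-trans a<b b<u) , (<-trans ε<a a<b , b<u) , inj₁ a<b)
  A⇒zero⊎anchored (inj₂ (_ , _ , y≠0 , inj₂ y<₀w)) with <₀-nonzero⇒ascending y≠0 y<₀w
  ... | b , a , _ , w≈Ca , ε<b , b<a , a<u =
    inj₂ (a , b , w≈Ca , (<-trans ε<b b<a , a<u) , (ε<b , <-trans b<a a<u) , inj₂ b<a)

  anchored⇒A : ∀ {w} → Anchored w → A w
  anchored⇒A {w} (d , e , w≈Cd , Id , Ie , d⋚e) =
    inj₂ (w≠0 , e , interior-nonzero Ie , comparison d⋚e)
    where
    w≠0 : ¬ (w ≈C ε)
    w≠0 w≈Cε = interior-nonzero Id (≈C-trans (≈C-sym w≈Cd) w≈Cε)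
    w≉e : ¬ (w ≈C e)
    w≉e = comparable-incongruent w≈Cd Id Ie d⋚e
    comparison : (d < e) ⊎ (e < d) → (w <₀ e) ⊎ (e <₀ w)
    comparison (inj₁ d<e) =
      inj₁ (inj₁ (ascending⇒R₀ (d , e , w≈Cd , ≈⇒≈C refl , proj₁ Id , d<e , proj₂ Ie)) , w≉e)
    comparison (inj₂ e<d) =
      inj₂ (inj₁ (ascending⇒R₀ (e , d , ≈⇒≈C refl , w≈Cd , proj₁ Ie , e<d , proj₂ Id)) ,
            λ e≈Cw → w≉e (≈C-sym e≈Cw))

  A-resp : x ≈C y → A x → A y
  A-resp x≈Cy ax with A⇒zero⊎anchored ax
  ... | inj₁ x≈Cε = inj₁ (≈C-trans (≈C-sym x≈Cy) x≈Cε)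
  ... | inj₂ (d , e , x≈Cd , rest) = anchored⇒A (d , e , ≈C-trans (≈C-sym x≈Cy) x≈Cd , rest)

  anchored-⁻¹ : Anchored w → Anchored (w ⁻¹)
  anchored-⁻¹ (d , e , w≈Cd , Id , Ie , d⋚e) =
    u ∙ d ⁻¹ , u ∙ e ⁻¹ , ≈C-trans (≈C-⁻¹ w≈Cd) (≈C-sym u-d≈C-d) ,
    interior-reflect Id , interior-reflect Ie , reflect-order d⋚e
    where
    u-d≈C-d : (u ∙ d ⁻¹) ≈C (d ⁻¹)
    u-d≈C-d = ≈C-trans (≈C-∙ u≈Cε (≈⇒≈C refl)) (≈⇒≈C (identityˡ _))
    reflect-order : (d < e) ⊎ (e < d) → ((u ∙ d ⁻¹) < (u ∙ e ⁻¹)) ⊎ ((u ∙ e ⁻¹) < (u ∙ d ⁻¹))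
    reflect-order (inj₁ d<e) = inj₂ (<-translateˡ u (⁻¹-antitone d<e))
    reflect-order (inj₂ e<d) = inj₁ (<-translateˡ u (⁻¹-antitone e<d))

  A-⁻¹ : A w → A (w ⁻¹)
  A-⁻¹ aw with A⇒zero⊎anchored aw
  ... | inj₁ w≈Cε = inj₁ (≈C-trans (≈C-⁻¹ w≈Cε) (≈⇒≈C ε⁻¹≈ε))
  ... | inj₂ anchored = anchored⇒A (anchored-⁻¹ anchored)

  A-difference-swap : ∀ {x y} → A (x ∙ y ⁻¹) → A (y ∙ x ⁻¹)
  A-difference-swap {x} {y} a = A-resp (≈⇒≈C (⁻¹-anti-homo-// x y)) (A-⁻¹ a)

  R₀⇒anchored-difference : R ε x y → Anchored (y ∙ x ⁻¹)
  R₀⇒anchored-difference r with R₀⇒ascending r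
  ... | a , b , x≈Ca , y≈Cb , ε<a , a<b , b<u =
    b ∙ a ⁻¹ , b , ≈C-∙ y≈Cb (≈C-⁻¹ x≈Ca) ,
    (<⇒difference-positive a<b , <-trans b-a<b b<u) , (<-trans ε<a a<b , b<u) , inj₁ b-a<b
    where
    b-a<b : (b ∙ a ⁻¹) < b
    b-a<b = positive⇒difference< b ε<a

  ≤₀⇒A-difference : ∀ {x y} → A y → x ≤₀ y → A (y ∙ x ⁻¹)
  ≤₀⇒A-difference _ (inj₁ r) = anchored⇒A (R₀⇒anchored-difference r)
  ≤₀⇒A-difference {x} _ (inj₂ (inj₁ x≈Cy)) =
    inj₁ (≈C-trans (≈C-∙ (≈C-sym x≈Cy) (≈⇒≈C refl)) (≈⇒≈C (inverseʳ x)))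
  ≤₀⇒A-difference {x} {y} ay (inj₂ (inj₂ x≈Cε)) = A-resp y≈Cy-x ay
    where
    y≈Cy-x : y ≈C (y ∙ x ⁻¹)
    y≈Cy-x = ≈C-trans (≈⇒≈C (sym (trans (∙-congˡ ε⁻¹≈ε) (identityʳ y))))
                      (≈C-∙ (≈⇒≈C refl) (≈C-⁻¹ (≈C-sym x≈Cε)))

  A-difference⇒comparable : ∀ {x y} → A x → A y → A (y ∙ x ⁻¹) → (x ≤₀ y) ⊎ (y ≤₀ x)
  A-difference⇒comparable {x} {y} ax ay ad
    with A⇒zero⊎anchored ad | A⇒zero⊎anchored ax | A⇒zero⊎anchored ay
  ... | inj₁ y-x≈Cε | _ | _ = inj₂ (inj₂ (inj₁ y≈Cx))
    where
    y≈Cx : y ≈C x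
    y≈Cx = ≈C-trans (≈⇒≈C (sym (//-rightDividesˡ x y)))
                    (≈C-trans (≈C-∙ y-x≈Cε (≈⇒≈C refl)) (≈⇒≈C (identityˡ x)))
  ... | inj₂ _ | inj₁ x≈Cε | _ = inj₁ (inj₂ (inj₂ x≈Cε))
  ... | inj₂ _ | inj₂ _ | inj₁ y≈Cε = inj₂ (inj₂ (inj₂ y≈Cε))
  ... | inj₂ (z , _ , y-x≈Cz , Iz , _) | inj₂ (a , _ , x≈Ca , Ia , _) | inj₂ (b , _ , y≈Cb , Ib , _)
    with interior-sum-comparable Iz Ia Ib z+a≈Cb
    where
    z+a≈Cb : (z ∙ a) ≈C b
    z+a≈Cb = ≈C-trans (≈C-∙ (≈C-sym y-x≈Cz) (≈C-sym x≈Ca))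
                      (≈C-trans (≈⇒≈C (//-rightDividesˡ x y)) y≈Cb)
  ...   | inj₁ a<b = inj₁ (inj₁ (ascending⇒R₀ (a , b , x≈Ca , y≈Cb , proj₁ Ia , a<b , proj₂ Ib)))
  ...   | inj₂ b<a = inj₂ (inj₁ (ascending⇒R₀ (b , a , y≈Cb , x≈Ca , proj₁ Ib , b<a , proj₂ Ia)))

  A-difference⇔comparable : ∀ {x y} → A x → A y → A (y ∙ x ⁻¹) ⇔ ((x ≤₀ y) ⊎ (y ≤₀ x))
  A-difference⇔comparable {x} {y} ax ay = mk⇔ (A-difference⇒comparable ax ay) comparable⇒A-difference
    where
    comparable⇒A-difference : (x ≤₀ y) ⊎ (y ≤₀ x) → A (y ∙ x ⁻¹)
    comparable⇒A-difference (inj₁ x≤₀y) = ≤₀⇒A-difference ay x≤₀y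
    comparable⇒A-difference (inj₂ y≤₀x) = A-difference-swap (≤₀⇒A-difference ax y≤₀x)

  A-sum⇔A-difference : ∀ {x y} → A (x ∙ y) ⇔ A (y ⁻¹ ∙ x ⁻¹)
  A-sum⇔A-difference {x} {y} =
    mk⇔ (λ a → A-resp (≈⇒≈C (sym -y-x≈-[x+y])) (A-⁻¹ a))
        (λ a → A-resp (≈⇒≈C (trans (⁻¹-cong -y-x≈-[x+y]) (⁻¹-involutive _))) (A-⁻¹ a))
    where
    -y-x≈-[x+y] : y ⁻¹ ∙ x ⁻¹ ≈ (x ∙ y) ⁻¹
    -y-x≈-[x+y] = sym (⁻¹-anti-homo-∙ x y)

proposition3p27 : ∀ {c ℓ₁ ℓ₂ : Level} (G : UnitalPOGroup c ℓ₁ ℓ₂) →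
    let open UnitalPOGroup G in
    ∀ x y → A x → A y →
      (A (y ∙ (x ⁻¹)) ⇔ ((x ≤₀ y) ⊎ (y ≤₀ x)))
      × (A (x ∙ y) ⇔ ((x ≤₀ (y ⁻¹)) ⊎ ((y ⁻¹) ≤₀ x)))
proposition3p27 G x y ax ay =
  A-difference⇔comparable ax ay ,
  A-difference⇔comparable ax (A-⁻¹ ay) ⇔-∘ A-sum⇔A-difference
  where open WoundRound G
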